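{- Let $i\in V$. The inequality $\sum_{a\in \check{A}^{ - }_{i}} y_a+ \sum_{a\in \check{A}^{+}_{i}} y_a \geq z_i$ is valid for $\mathcal{P}$.
   Context: Let $G=(V,A)$ be a DAG with $V=\{1,\dots,n\}$ and $\check{A}\subseteq A$. Let $\bar{G}=(\bar V,\bar A)$ with $\bar V=\{0\}\cup V\cup\{\bar n\}$, $\bar n=n+1$, and $\bar A=\{(0,i):i\in V\}\cup A\cup\{(i,\bar n):i\in V\}$. For $S\subseteq\bar V$, $\delta^+(S)$ (resp. $\delta^-(S)$) denotes the arcs of $\bar A$ leaving (resp. entering) $S$. A path $(0,v_1,\dots,v_h,\bar n)$ in $\bar G$ is feasible if it traverses at least one arc of $\check{A}$, and infeasible otherwise. $\mathcal{P}$ is the convex hull of all binary vectors $y\in\{0,1\}^{|\bar A|}$ satisfying $\sum_{a\in\delta^-(i)}y_a\le 1$ and $\sum_{a\in\delta^-(i)}y_a=\sum_{a\in\delta^+(i)}y_a$ for all $i\in V$, and $\sum_{i=0}^h y_{(v_i,v_{i+1})}\le h$ for every infeasible path $(v_0=0,v_1,\dots,v_h,v_{h+1}=\bar n)$. For each node $i\in\bar V$, $\check{A}^{ - }_{i}$ is the set of arcs of $\check{A}$ from which there exists a path to $i$, and $\check{A}^{+}_{i}$ is the set of arcs of $\check{A}$ to which there exists a path from $i$. For $i\in V$, $z_i=\sum_{a\in\delta^-(i)}y_a$.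
   Formalization: The vectors y have rational coordinates, and 𝒫 is taken as the set of rational-weight convex combinations of the feasible binary points rather than their real convex hull. -}

module Defs where

open import Data.Nat using (ℕ)
open import Data.Fin using (Fin)
open import Data.Bool using (Bool; true; false; T; _∧_; if_then_else_)
open import Data.List using (List; []; _∷_; map; _++_; [_]; length; concatMap; allFin; foldr)
open import Data.List.Relation.Unary.All using (All)
open import Data.Product using (_×_; _,_; Σ; ∃)
open import Data.Sum using (_⊎_)
open import Data.Empty using (⊥)
open import Relation.Nullary using (¬_)
open import Relation.Binary.PropositionalEquality using (_≡_)
open import Relation.Binary.Construct.Closure.ReflexiveTransitive using (Star)
open import Relation.Binary.Construct.Closure.Transitive using (TransClosure)
open import Data.Rational using (ℚ; 0ℚ; 1ℚ; _+_; _*_; _≤_)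
import Data.Rational as Q
import Data.Integer
open import Data.Fin using (_≟_)
open import Relation.Nullary.Decidable using (⌊_⌋)

-- Nodes of the extended graph Ḡ : source 0, the nodes of V = Fin n, sink n̄.
data Node (n : ℕ) : Set where
  src : Node n
  v   : Fin n → Node n
  snk : Node n

Graph : ℕ → Set
Graph n = Fin n → Fin n → Bool

Arc : ∀ {n} → Graph n → Fin n → Fin n → Set
Arc A i j = T (A i j)

Acyclic : ∀ {n} → Graph n → Set
Acyclic {n} A = (u : Fin n) → ¬ TransClosure (Arc A) u u

Sub : ∀ {n} → Graph n → Graph n → Set
Sub {n} B A = (i j : Fin n) → T (B i j) → T (A i j)

Abar : ∀ {n} → Graph n → Node n → Node n → Bool
Abar A src   (v j) = true
Abar A (v i) (v j) = A i j
Abar A (v i) snk   = true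
Abar A _     _     = false

lift : ∀ {n} → Graph n → Node n → Node n → Bool
lift B (v i) (v j) = B i j
lift B _     _     = false

nodes : (n : ℕ) → List (Node n)
nodes n = src ∷ map v (allFin n) ++ [ snk ]

pairs : (n : ℕ) → List (Node n × Node n)
pairs n = concatMap (λ a → map (λ b → (a , b)) (nodes n)) (nodes n)

-- vectors indexed by pairs of nodes (coordinates off Ā are required to be 0)
Vector : ℕ → Set
Vector n = Node n → Node n → ℚ

sumQ : List ℚ → ℚ
sumQ = foldr _+_ 0ℚ

sumArcs : ∀ {n} → Graph n → (Node n → Node n → Bool) → Vector n → ℚ
sumArcs {n} A P y =
  sumQ (map (λ { (a , b) → if Abar A a b ∧ P a b then y a b else 0ℚ }) (pairs n))

isV : ∀ {n} → Fin n → Node n → Bool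
isV i (v j) = ⌊ j ≟ i ⌋
isV i _     = false

inflow : ∀ {n} → Graph n → Vector n → Fin n → ℚ
inflow A y i = sumArcs A (λ a b → isV i b) y

outflow : ∀ {n} → Graph n → Vector n → Fin n → ℚ
outflow A y i = sumArcs A (λ a b → isV i a) y

z : ∀ {n} → Graph n → Vector n → Fin n → ℚ
z = inflow

steps : ∀ {n} → List (Node n) → List (Node n × Node n)
steps []           = []
steps (a ∷ [])     = []
steps (a ∷ b ∷ l)  = (a , b) ∷ steps (b ∷ l)

stPath : ∀ {n} → List (Fin n) → List (Node n)
stPath vs = src ∷ map v vs ++ [ snk ]

IsPath : ∀ {n} → Graph n → List (Fin n) → Set
IsPath A vs = All (λ { (a , b) → T (Abar A a b) }) (steps (stPath vs))

Infeasible : ∀ {n} → Graph n → List (Fin n) → Set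
Infeasible Ac vs = All (λ { (a , b) → lift Ac a b ≡ false }) (steps (stPath vs))

pathSum : ∀ {n} → Vector n → List (Fin n) → ℚ
pathSum y vs = sumQ (map (λ { (a , b) → y a b }) (steps (stPath vs)))

ℕtoℚ : ℕ → ℚ
ℕtoℚ k = (Data.Integer.+ k) Q./ 1

IsFeasibleBinary : ∀ {n} → Graph n → Graph n → Vector n → Set
IsFeasibleBinary {n} A Ac y =
  ((a b : Node n) → (y a b ≡ 0ℚ) ⊎ (y a b ≡ 1ℚ)) ×
  ((a b : Node n) → Abar A a b ≡ false → y a b ≡ 0ℚ) ×
  ((i : Fin n) → inflow A y i ≤ 1ℚ) ×
  ((i : Fin n) → inflow A y i ≡ outflow A y i) ×
  ((vs : List (Fin n)) → IsPath A vs → Infeasible Ac vs →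
     pathSum y vs ≤ ℕtoℚ (length vs))

-- 𝒫 : convex hull (finite convex combinations with rational weights)
InHull : ∀ {n} → Graph n → Graph n → Vector n → Set
InHull {n} A Ac y =
  Σ (List (ℚ × Vector n)) λ cs →
    All (λ { (λk , x) → (0ℚ ≤ λk) × IsFeasibleBinary A Ac x }) cs ×
    (sumQ (map (λ { (λk , x) → λk }) cs) ≡ 1ℚ) ×
    ((a b : Node n) → y a b ≡ sumQ (map (λ { (λk , x) → λk * x a b }) cs))

-- characterisations of the arc sets Ǎ⁻_i and Ǎ⁺_i (given as Boolean predicates)
IsAcheckMinus : ∀ {n} → Graph n → Graph n → Fin n → Graph n → Set
IsAcheckMinus {n} A Ac i M =
  (a b : Fin n) → (T (M a b) → T (Ac a b) × Star (Arc A) b i)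
                × (T (Ac a b) × Star (Arc A) b i → T (M a b))

IsAcheckPlus : ∀ {n} → Graph n → Graph n → Fin n → Graph n → Set
IsAcheckPlus {n} A Ac i P =
  (a b : Fin n) → (T (P a b) → T (Ac a b) × Star (Arc A) i a)
                × (T (Ac a b) × Star (Arc A) i a → T (P a b))

{-# OPTIONS --safe #-}

-- Both sides are linear in y, so it suffices to check binary points of 𝒫. If a
-- binary y enters i, flow conservation lets us follow its arcs forward from i until
-- one lies in Ǎ (it is then in Ǎ⁺_i) or n̄ is reached, and backward from i until one
-- lies in Ǎ (it is then in Ǎ⁻_i) or 0 is reached; acyclicity makes both walks
-- terminate. Were neither walk to meet Ǎ, together they would form an infeasible
-- path (0, v_1, ..., v_h, n̄) all of whose h + 1 arcs carry flow 1, violating its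
-- path inequality. So z_i = 1 forces one of the two sums to be at least 1.

module Submission where

open import Defs
open import Algebra.Bundles using (CommutativeMonoid)
open import Data.Bool using (Bool; true; false; T; _∧_; if_then_else_)
open import Data.Bool.Properties using (T-≡; T-∧)
open import Data.Empty using (⊥-elim)
open import Data.Fin using (Fin)
open import Data.Fin.Induction using (spo-wellFounded; spo-noetherian)
import Data.Integer as ℤ
import Data.Integer.Properties as ℤ
open import Data.List using (List; []; _∷_; map; _++_; [_]; length; allFin)
open import Data.List.Membership.Propositional using (_∈_)
open import Data.List.Membership.Propositional.Properties
  using (∈-concat⁺′; ∈-map⁺; ∈-++⁺ˡ; ∈-++⁺ʳ; ∈-allFin)
open import Data.List.Properties using (length-++; length-map)
open import Data.List.Relation.Unary.All as All using (All; []; _∷_)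
open import Data.List.Relation.Unary.Any as Any using (Any; here; there)
open import Data.Nat as ℕ using (ℕ; suc)
import Data.Nat.Properties as ℕ
open import Data.Nat.Coprimality using (1-coprimeTo) renaming (sym to coprime-sym)
open import Data.Product using (_×_; _,_; proj₁; proj₂; ∃; ∃₂)
open import Data.Rational using (ℚ; 0ℚ; 1ℚ; _+_; _*_; _≤_; _/_; mkℚ; *≤*; nonNegative)
open import Data.Rational.Properties
open import Data.Sum using (_⊎_; inj₁; inj₂)
open import Function using (flip; Equivalence)
open import Induction.WellFounded using (WellFounded; Acc; acc; module Subrelation)
open import Relation.Binary.Construct.Closure.ReflexiveTransitive using (Star; ε; _◅_; _◅◅_)
open import Relation.Binary.Construct.Closure.Transitive as Transitive
  using (TransClosure) renaming ([_] to [_]⁺)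
open import Relation.Binary.PropositionalEquality
  using (_≡_; refl; sym; trans; cong; cong₂; subst; subst₂; isEquivalence; resp₂; module ≡-Reasoning)
open import Relation.Binary.Structures using (IsStrictPartialOrder)
open import Relation.Nullary using (¬_)
open import Relation.Nullary.Decidable using (toWitness; fromWitness)

open import Algebra.Properties.CommutativeSemigroup
  (CommutativeMonoid.commutativeSemigroup +-0-commutativeMonoid)
  using () renaming (interchange to +-interchange)

module _ {n : ℕ} {R : Fin n → Fin n → Set} (acyclic : ∀ u → ¬ TransClosure R u u) where

  transClosure-isStrictPartialOrder : IsStrictPartialOrder _≡_ (TransClosure R)
  transClosure-isStrictPartialOrder = record
    { isEquivalence = isEquivalence
    ; irrefl        = λ { refl → acyclic _ }
    ; trans         = Transitive.transitive R
    ; <-resp-≈      = resp₂ (TransClosure R)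
    }

  acyclic⇒wellFounded : WellFounded R
  acyclic⇒wellFounded =
    Transitive.wellFounded⁻ R (spo-wellFounded transClosure-isStrictPartialOrder)

  acyclic⇒noetherian : WellFounded (flip R)
  acyclic⇒noetherian =
    Subrelation.wellFounded [_]⁺ (spo-noetherian transClosure-isStrictPartialOrder)

ℕtoℚ-mkℚ : ∀ k → ℕtoℚ k ≡ mkℚ (ℤ.+ k) 0 (coprime-sym (1-coprimeTo k))
ℕtoℚ-mkℚ k = normalize-coprime (coprime-sym (1-coprimeTo k))

ℕtoℚ-suc : ∀ k → ℕtoℚ (suc k) ≡ 1ℚ + ℕtoℚ k
-- 1ℚ + mkℚ (+ k) 0 _ unfolds to (+ 1 ℤ.+ + k ℤ.* + 1) / 1.
ℕtoℚ-suc k = trans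
  (cong (λ m → (ℤ.+ 1 ℤ.+ m) / 1) (sym (ℤ.*-identityʳ (ℤ.+ k))))
  (cong (1ℚ +_) (sym (ℕtoℚ-mkℚ k)))

ℕtoℚ-cancel-≤ : ∀ {m k} → ℕtoℚ m ≤ ℕtoℚ k → m ℕ.≤ k
ℕtoℚ-cancel-≤ {m} {k} m≤k rewrite ℕtoℚ-mkℚ m | ℕtoℚ-mkℚ k with m≤k
... | *≤* m*1≤k*1 = ℤ.drop‿+≤+
  (subst₂ ℤ._≤_ (ℤ.*-identityʳ (ℤ.+ m)) (ℤ.*-identityʳ (ℤ.+ k)) m*1≤k*1)

0≤1 : 0ℚ ≤ 1ℚ
0≤1 = nonNegative⁻¹ 1ℚ

1≰0 : ¬ 1ℚ ≤ 0ℚ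
1≰0 (*≤* (ℤ.+≤+ ()))

p≤p+q : ∀ p {q} → 0ℚ ≤ q → p ≤ p + q
p≤p+q p {q} q≥0 = subst (_≤ p + q) (+-identityʳ p) (+-mono-≤ (≤-refl {p}) q≥0)

p≤q+p : ∀ p {q} → 0ℚ ≤ q → p ≤ q + p
p≤q+p p {q} q≥0 = subst (_≤ q + p) (+-identityˡ p) (+-mono-≤ q≥0 (≤-refl {p}))

module _ {X : Set} where

  sumQ-map-cong : ∀ {f g : X → ℚ} → (∀ p → f p ≡ g p) → ∀ xs →
                  sumQ (map f xs) ≡ sumQ (map g xs)
  sumQ-map-cong f≡g []       = refl
  sumQ-map-cong f≡g (x ∷ xs) = cong₂ _+_ (f≡g x) (sumQ-map-cong f≡g xs)

  sumQ-map-zero : ∀ {f : X → ℚ} → (∀ p → f p ≡ 0ℚ) → ∀ xs → sumQ (map f xs) ≡ 0ℚ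
  sumQ-map-zero f≡0 []       = refl
  sumQ-map-zero f≡0 (x ∷ xs) rewrite f≡0 x | sumQ-map-zero f≡0 xs = refl

  sumQ-map-+ : ∀ (f g : X → ℚ) xs →
               sumQ (map (λ p → f p + g p) xs) ≡ sumQ (map f xs) + sumQ (map g xs)
  sumQ-map-+ f g []       = refl
  sumQ-map-+ f g (x ∷ xs) rewrite sumQ-map-+ f g xs = +-interchange (f x) (g x) _ _

  sumQ-map-*ˡ : ∀ c (f : X → ℚ) xs → sumQ (map (λ p → c * f p) xs) ≡ c * sumQ (map f xs)
  sumQ-map-*ˡ c f []       = sym (*-zeroʳ c)
  sumQ-map-*ˡ c f (x ∷ xs) rewrite sumQ-map-*ˡ c f xs = sym (*-distribˡ-+ c (f x) _)

  sumQ-map-nonNeg : ∀ {f : X → ℚ} → (∀ p → 0ℚ ≤ f p) → ∀ xs → 0ℚ ≤ sumQ (map f xs)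
  sumQ-map-nonNeg f≥0 []       = ≤-refl
  sumQ-map-nonNeg f≥0 (x ∷ xs) = +-mono-≤ (f≥0 x) (sumQ-map-nonNeg f≥0 xs)

  sumQ-map-mono : ∀ {P : X → Set} {f g : X → ℚ} → (∀ p → P p → f p ≤ g p) →
                  ∀ {xs} → All P xs → sumQ (map f xs) ≤ sumQ (map g xs)
  sumQ-map-mono f≤g []         = ≤-refl
  sumQ-map-mono f≤g (px ∷ pxs) = +-mono-≤ (f≤g _ px) (sumQ-map-mono f≤g pxs)

  ∈⇒≤sumQ-map : ∀ {f : X → ℚ} → (∀ p → 0ℚ ≤ f p) → ∀ {x xs} → x ∈ xs →
                f x ≤ sumQ (map f xs)
  ∈⇒≤sumQ-map {f} f≥0 {xs = x ∷ xs} (here refl) =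
    subst (_≤ f x + sumQ (map f xs)) (+-identityʳ (f x))
          (+-mono-≤ (≤-refl {f x}) (sumQ-map-nonNeg f≥0 xs))
  ∈⇒≤sumQ-map {f} f≥0 {xs = y ∷ xs} (there x∈xs) =
    subst (_≤ f y + sumQ (map f xs)) (+-identityˡ _)
          (+-mono-≤ (f≥0 y) (∈⇒≤sumQ-map f≥0 x∈xs))

  sumQ-map-ones : ∀ {f : X → ℚ} {xs} → All (λ p → f p ≡ 1ℚ) xs →
                  sumQ (map f xs) ≡ ℕtoℚ (length xs)
  sumQ-map-ones []                       = refl
  sumQ-map-ones {xs = _ ∷ xs} (f≡1 ∷ fs≡1) rewrite f≡1 | sumQ-map-ones fs≡1 =
    sym (ℕtoℚ-suc (length xs))

  sumQ-map-binary : ∀ {f : X → ℚ} → (∀ p → f p ≡ 0ℚ ⊎ f p ≡ 1ℚ) → ∀ xs →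
                    sumQ (map f xs) ≡ 0ℚ ⊎ Any (λ p → f p ≡ 1ℚ) xs
  sumQ-map-binary f01 []       = inj₁ refl
  sumQ-map-binary f01 (x ∷ xs) with f01 x | sumQ-map-binary f01 xs
  ... | inj₂ fx≡1 | _          = inj₂ (here fx≡1)
  ... | inj₁ _    | inj₂ any   = inj₂ (there any)
  ... | inj₁ fx≡0 | inj₁ sum≡0 rewrite fx≡0 | sum≡0 = inj₁ refl

sumQ-map-comm : ∀ {X C : Set} (F : C → X → ℚ) xs cs →
  sumQ (map (λ p → sumQ (map (λ c → F c p) cs)) xs) ≡ sumQ (map (λ c → sumQ (map (F c) xs)) cs)
sumQ-map-comm F []       cs = sym (sumQ-map-zero (λ _ → refl) cs)
sumQ-map-comm F (x ∷ xs) cs rewrite sumQ-map-comm F xs cs =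
  sym (sumQ-map-+ (λ c → F c x) (λ c → sumQ (map (F c) xs)) cs)

module _ {n : ℕ} where

  ∈-nodes : (a : Node n) → a ∈ nodes n
  ∈-nodes src   = here refl
  ∈-nodes (v j) = there (∈-++⁺ˡ (∈-map⁺ v (∈-allFin j)))
  ∈-nodes snk   = there (∈-++⁺ʳ (map v (allFin n)) (here refl))

  ∈-pairs : (a b : Node n) → (a , b) ∈ pairs n
  ∈-pairs a b = ∈-concat⁺′ (∈-map⁺ (a ,_) (∈-nodes b)) (∈-map⁺ (λ c → map (c ,_) (nodes n)) (∈-nodes a))

  isV-refl : (j : Fin n) → T (isV j (v j))
  isV-refl j = fromWitness refl

  isV⇒≡v : (j : Fin n) (b : Node n) → T (isV j b) → b ≡ v j
  isV⇒≡v j (v k) k≡j = cong v (toWitness k≡j)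

  length-steps : (a : Node n) (ns : List (Node n)) → length (steps (a ∷ ns)) ≡ length ns
  length-steps a []       = refl
  length-steps a (b ∷ ns) = cong suc (length-steps b ns)

  length-steps-stPath : (vs : List (Fin n)) → length (steps (stPath vs)) ≡ suc (length vs)
  length-steps-stPath vs = begin
    length (steps (stPath vs))         ≡⟨ length-steps src (map v vs ++ [ snk ]) ⟩
    length (map v vs ++ [ snk ])       ≡⟨ length-++ (map v vs) ⟩
    length (map v vs) ℕ.+ 1            ≡⟨ cong (ℕ._+ 1) (length-map v vs) ⟩
    length vs ℕ.+ 1                    ≡⟨ ℕ.+-comm (length vs) 1 ⟩
    suc (length vs)                    ∎
    where open ≡-Reasoning

  arcTerm : Graph n → (Node n → Node n → Bool) → Vector n → Node n × Node n → ℚ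
  arcTerm A P y (a , b) = if Abar A a b ∧ P a b then y a b else 0ℚ

module _ {V : Set} where

  weighted : List (ℚ × V) → (V → ℚ) → ℚ
  weighted cs F = sumQ (map (λ (w , x) → w * F x) cs)

  weighted-+ : ∀ cs (F G : V → ℚ) → weighted cs (λ x → F x + G x) ≡ weighted cs F + weighted cs G
  weighted-+ cs F G = trans (sumQ-map-cong (λ (w , x) → *-distribˡ-+ w (F x) (G x)) cs)
                            (sumQ-map-+ _ _ cs)

  weighted-mono : ∀ {Q : V → Set} {F G : V → ℚ} → (∀ x → Q x → F x ≤ G x) →
                  ∀ {cs} → All (λ (w , x) → 0ℚ ≤ w × Q x) cs → weighted cs F ≤ weighted cs G
  weighted-mono F≤G = sumQ-map-mono
    (λ (w , x) (w≥0 , Qx) → *-monoˡ-≤-nonNeg w {{nonNegative w≥0}} (F≤G x Qx))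

sumArcs-weighted : ∀ {n} (A : Graph n) P cs (y : Vector n) →
  (∀ a b → y a b ≡ sumQ (map (λ (w , x) → w * x a b) cs)) →
  sumArcs A P y ≡ weighted cs (sumArcs A P)
sumArcs-weighted {n} A P cs y y≡ = begin
  sumQ (map (arcTerm A P y) (pairs n))
    ≡⟨ sumQ-map-cong arcTerm-weighted (pairs n) ⟩
  sumQ (map (λ p → sumQ (map (λ (w , x) → w * arcTerm A P x p) cs)) (pairs n))
    ≡⟨ sumQ-map-comm (λ (w , x) p → w * arcTerm A P x p) (pairs n) cs ⟩
  sumQ (map (λ (w , x) → sumQ (map (λ p → w * arcTerm A P x p) (pairs n))) cs)
    ≡⟨ sumQ-map-cong (λ (w , x) → sumQ-map-*ˡ w (arcTerm A P x) (pairs n)) cs ⟩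
  weighted cs (sumArcs A P) ∎
  where
  open ≡-Reasoning
  arcTerm-weighted : ∀ p → arcTerm A P y p ≡ sumQ (map (λ (w , x) → w * arcTerm A P x p) cs)
  arcTerm-weighted (a , b) with Abar A a b ∧ P a b
  ... | true  = y≡ a b
  ... | false = sym (sumQ-map-zero (λ (w , _) → *-zeroʳ w) cs)

module BinaryFlow {n : ℕ} (A : Graph n) (x : Vector n)
  (binary    : ∀ a b → x a b ≡ 0ℚ ⊎ x a b ≡ 1ℚ)
  (supported : ∀ a b → Abar A a b ≡ false → x a b ≡ 0ℚ)
  (conserved : ∀ j → inflow A x j ≡ outflow A x j)
  where

  Carries : Node n → Node n → Set
  Carries a b = x a b ≡ 1ℚ

  carries⇒arc : ∀ {a b} → Carries a b → T (Abar A a b)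
  carries⇒arc {a} {b} x≡1 with Abar A a b in eq
  ... | true  = _
  ... | false = 1≰0 (subst (_≤ 0ℚ) x≡1 (≤-reflexive (supported a b eq)))

  arcTerm-binary : ∀ P p → arcTerm A P x p ≡ 0ℚ ⊎ arcTerm A P x p ≡ 1ℚ
  arcTerm-binary P (a , b) with Abar A a b ∧ P a b
  ... | true  = binary a b
  ... | false = inj₁ refl

  arcTerm-nonNeg : ∀ P p → 0ℚ ≤ arcTerm A P x p
  arcTerm-nonNeg P p with arcTerm-binary P p
  ... | inj₁ t≡0 = ≤-reflexive (sym t≡0)
  ... | inj₂ t≡1 = subst (0ℚ ≤_) (sym t≡1) 0≤1

  sumArcs-nonNeg : ∀ P → 0ℚ ≤ sumArcs A P x
  sumArcs-nonNeg P = sumQ-map-nonNeg (arcTerm-nonNeg P) (pairs n)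

  arcTerm-carries : ∀ P {a b} → T (P a b) → Carries a b → arcTerm A P x (a , b) ≡ 1ℚ
  arcTerm-carries P Pab x≡1
    rewrite Equivalence.to T-≡ (Equivalence.from T-∧ (carries⇒arc x≡1 , Pab)) = x≡1

  arcTerm≡1⇒carries : ∀ P a b → arcTerm A P x (a , b) ≡ 1ℚ → T (P a b) × Carries a b
  arcTerm≡1⇒carries P a b term≡1 with Abar A a b | P a b
  ... | true  | true  = _ , term≡1
  ... | true  | false = ⊥-elim (1≰0 (≤-reflexive (sym term≡1)))
  ... | false | _     = ⊥-elim (1≰0 (≤-reflexive (sym term≡1)))

  carries⇒1≤sumArcs : ∀ P {a b} → T (P a b) → Carries a b → 1ℚ ≤ sumArcs A P x
  carries⇒1≤sumArcs P {a} {b} Pab x≡1 = subst (_≤ sumArcs A P x) (arcTerm-carries P Pab x≡1)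
    (∈⇒≤sumQ-map (arcTerm-nonNeg P) (∈-pairs a b))

  Carrying : (Node n → Node n → Bool) → Set
  Carrying P = ∃₂ λ a b → T (P a b) × Carries a b

  sumArcs≡0⊎carrying : ∀ P → sumArcs A P x ≡ 0ℚ ⊎ Carrying P
  sumArcs≡0⊎carrying P with sumQ-map-binary (arcTerm-binary P) (pairs n)
  ... | inj₁ sum≡0 = inj₁ sum≡0
  ... | inj₂ some with Any.satisfied some
  ...   | (a , b) , term≡1 = inj₂ (a , b , arcTerm≡1⇒carries P a b term≡1)

  1≤sumArcs⇒carrying : ∀ P → 1ℚ ≤ sumArcs A P x → Carrying P
  1≤sumArcs⇒carrying P 1≤sum with sumArcs≡0⊎carrying P
  ... | inj₁ sum≡0   = ⊥-elim (1≰0 (subst (1ℚ ≤_) sum≡0 1≤sum))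
  ... | inj₂ carried = carried

  carriesIn⇒carriesOut : ∀ {u j} → Carries u (v j) → ∃ λ w → Carries (v j) w
  carriesIn⇒carriesOut {u} {j} carries
    with 1≤sumArcs⇒carrying (λ a _ → isV j a)
           (subst (1ℚ ≤_) (conserved j) (carries⇒1≤sumArcs (λ _ b → isV j b) (isV-refl j) carries))
  ... | a , w , a≡j , carries′ with isV⇒≡v j a a≡j
  ...   | refl = w , carries′

  carriesOut⇒carriesIn : ∀ {j w} → Carries (v j) w → ∃ λ u → Carries u (v j)
  carriesOut⇒carriesIn {j} {w} carries
    with 1≤sumArcs⇒carrying (λ _ b → isV j b)
           (subst (1ℚ ≤_) (sym (conserved j)) (carries⇒1≤sumArcs (λ a _ → isV j a) (isV-refl j) carries))
  ... | u , b , b≡j , carries′ with isV⇒≡v j b b≡j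
  ...   | refl = u , carries′

  module _ (Ac : Graph n) (i : Fin n) where

    PlainArc : Node n → Node n → Set
    PlainArc a b = lift Ac a b ≡ false × Carries a b

    PlainPath : List (Node n) → Set
    PlainPath ns = All (λ (a , b) → PlainArc a b) (steps ns)

    CarriesǍ⁻ CarriesǍ⁺ : Set
    CarriesǍ⁻ = ∃₂ λ a b → (T (Ac a b) × Star (Arc A) b i) × Carries (v a) (v b)
    CarriesǍ⁺ = ∃₂ λ a b → (T (Ac a b) × Star (Arc A) i a) × Carries (v a) (v b)

    forward : ∀ {j} → Acc (flip (Arc A)) j → Star (Arc A) i j → ∃ (Carries (v j)) →
              CarriesǍ⁺ ⊎ ∃ λ post → PlainPath (v j ∷ map v post ++ [ snk ])
    forward _ _ (src , carries) = ⊥-elim (carries⇒arc carries)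
    forward _ _ (snk , carries) = inj₂ ([] , (refl , carries) ∷ [])
    forward {j} (acc rec) i↝j (v m , carries) with Ac j m in checked
    ... | true  = inj₁ (j , m , (Equivalence.from T-≡ checked , i↝j) , carries)
    ... | false with forward (rec (carries⇒arc carries)) (i↝j ◅◅ carries⇒arc carries ◅ ε)
                             (carriesIn⇒carriesOut carries)
    ...   | inj₁ found          = inj₁ found
    ...   | inj₂ (post , path)  = inj₂ (m ∷ post , (checked , carries) ∷ path)

    backward : ∀ {j} → Acc (Arc A) j → Star (Arc A) j i → ∃ (λ u → Carries u (v j)) →
               ∀ post → PlainPath (v j ∷ map v post ++ [ snk ]) →
               CarriesǍ⁻ ⊎ ∃ λ vs → PlainPath (stPath vs)
    backward {j} _ _ (src , carries) post path = inj₂ (j ∷ post , (refl , carries) ∷ path)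
    backward     _ _ (snk , carries) post path = ⊥-elim (carries⇒arc carries)
    backward {j} (acc rec) j↝i (v k , carries) post path with Ac k j in checked
    ... | true  = inj₁ (k , j , (Equivalence.from T-≡ checked , j↝i) , carries)
    ... | false = backward (rec (carries⇒arc carries)) (carries⇒arc carries ◅ j↝i)
                           (carriesOut⇒carriesIn carries) (j ∷ post) ((checked , carries) ∷ path)

    plainPath-isPath : ∀ {vs} → PlainPath (stPath vs) → IsPath A vs
    plainPath-isPath = All.map (λ (_ , carries) → carries⇒arc carries)

    plainPath-infeasible : ∀ {vs} → PlainPath (stPath vs) → Infeasible Ac vs
    plainPath-infeasible = All.map proj₁

    plainPath-pathSum : ∀ {vs} → PlainPath (stPath vs) → pathSum x vs ≡ ℕtoℚ (suc (length vs))
    plainPath-pathSum {vs} path =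
      trans (sumQ-map-ones (All.map proj₂ path)) (cong ℕtoℚ (length-steps-stPath vs))

    module _ (acyclic : Acyclic A)
      (path-ineq : ∀ vs → IsPath A vs → Infeasible Ac vs → pathSum x vs ≤ ℕtoℚ (length vs))
      where

      no-plainPath : ∀ vs → ¬ PlainPath (stPath vs)
      no-plainPath vs path = ℕ.1+n≰n {length vs} (ℕtoℚ-cancel-≤
        (subst (_≤ ℕtoℚ (length vs)) (plainPath-pathSum path)
               (path-ineq vs (plainPath-isPath path) (plainPath-infeasible path))))

      carriesIn⇒carriesǍ⁻⊎carriesǍ⁺ : ∀ {u} → Carries u (v i) → CarriesǍ⁻ ⊎ CarriesǍ⁺
      carriesIn⇒carriesǍ⁻⊎carriesǍ⁺ {u} carries
        with forward (acyclic⇒noetherian acyclic i) ε (carriesIn⇒carriesOut carries)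
      ... | inj₁ after = inj₂ after
      ... | inj₂ (post , path)
        with backward (acyclic⇒wellFounded acyclic i) ε (u , carries) post path
      ...   | inj₁ before       = inj₁ before
      ...   | inj₂ (vs , path′) = ⊥-elim (no-plainPath vs path′)

binary-valid : ∀ {n} (A Ac : Graph n) → Acyclic A → (i : Fin n) (Minus Plus : Graph n) →
  IsAcheckMinus A Ac i Minus → IsAcheckPlus A Ac i Plus →
  (x : Vector n) → IsFeasibleBinary A Ac x →
  z A x i ≤ sumArcs A (lift Minus) x + sumArcs A (lift Plus) x
binary-valid A Ac acyclic i Minus Plus minus plus x
  (binary , supported , inflow≤1 , conserved , path-ineq) = inflow≤Minus+Plus
  where
  open BinaryFlow A x binary supported conserved

  inflow≤Minus+Plus : inflow A x i ≤ sumArcs A (lift Minus) x + sumArcs A (lift Plus) x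
  inflow≤Minus+Plus with sumArcs≡0⊎carrying (λ _ b → isV i b)
  ... | inj₁ inflow≡0 =
    subst (_≤ _) (sym inflow≡0) (+-mono-≤ (sumArcs-nonNeg (lift Minus)) (sumArcs-nonNeg (lift Plus)))
  ... | inj₂ (u , b , b≡i , carries) with isV⇒≡v i b b≡i
  ... | refl with carriesIn⇒carriesǍ⁻⊎carriesǍ⁺ Ac i acyclic path-ineq carries
  ... | inj₁ (a , b , inǍ⁻ , carries′) = ≤-trans (inflow≤1 i) (≤-trans
    (carries⇒1≤sumArcs (lift Minus) (proj₂ (minus a b) inǍ⁻) carries′)
    (p≤p+q _ (sumArcs-nonNeg (lift Plus))))
  ... | inj₂ (a , b , inǍ⁺ , carries′) = ≤-trans (inflow≤1 i) (≤-trans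
    (carries⇒1≤sumArcs (lift Plus) (proj₂ (plus a b) inǍ⁺) carries′)
    (p≤q+p _ (sumArcs-nonNeg (lift Minus))))

proposition5 : (n : ℕ) (A Ac : Graph n) → Acyclic A → Sub Ac A →
    (i : Fin n) (Minus Plus : Graph n) →
    IsAcheckMinus A Ac i Minus → IsAcheckPlus A Ac i Plus →
    (y : Vector n) → InHull A Ac y →
    z A y i ≤ sumArcs A (lift Minus) y + sumArcs A (lift Plus) y
proposition5 n A Ac acyclic _ i Minus Plus minus plus y (cs , points , _ , y≡) = begin
  inflow A y i                    ≡⟨ sumArcs-weighted A _ cs y y≡ ⟩
  weighted cs (λ x → inflow A x i) ≤⟨ weighted-mono (binary-valid A Ac acyclic i Minus Plus minus plus) points ⟩
  weighted cs (λ x → M x + P x)   ≡⟨ weighted-+ cs M P ⟩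
  weighted cs M + weighted cs P   ≡⟨ sym (cong₂ _+_ (sumArcs-weighted A _ cs y y≡)
                                                    (sumArcs-weighted A _ cs y y≡)) ⟩
  M y + P y                       ∎
  where
  open ≤-Reasoning
  M P : Vector n → ℚ
  M = sumArcs A (lift Minus)
  P = sumArcs A (lift Plus)
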